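{- For every $\varepsilon>0$ there exist an integer $d_\varepsilon$ and a function $f$ on the positive integers with $f(d)\le 1/2$, such that for all integers $d\ge d_\varepsilon$ and $N\ge1$, and every point $\mathbf a\in\mathcal W(d,N)$ with $\operatorname{dist}_d(\mathbf a,\mathbf c)\ge f(d)$, the proportion of triangles $(\mathbf a,\mathbf c,\mathbf v)$ with $\mathbf v\in\mathcal V(d,N)$ whose angle $\theta_{\mathbf c}(\mathbf v)$ at $\mathbf c$ satisfies $|\cos\theta_{\mathbf c}(\mathbf v)|\le\varepsilon$ is at least $1-\varepsilon$.
   Context: For integers $d,N\ge1$, $\mathcal W(d,N)=\{0,1,\dots,N\}^d$ and $\mathcal V(d,N)=\{0,N\}^d$ is the set of the $2^d$ vertices of $[0,N]^d$; $\mathbf c=(N/2,\dots,N/2)$ is the center of the hypercube. The normalized distance is $\operatorname{dist}_d(\mathbf u,\mathbf v)=\frac{1}{\sqrt d\,N}\bigl(\sum_{j=1}^d(u_j-v_j)^2\bigr)^{1/2}$. The proportion is taken over the $2^d$ vertices $\mathbf v$.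
   Formalization: The parameter ε ranges over the positive rationals, and the function f takes rational values. -}

module Defs where

open import Data.Nat as ℕ using (ℕ; zero; suc)
open import Data.Integer using (+_)
open import Data.Rational as ℚ using (ℚ; 0ℚ; 1ℚ; _+_; _*_; _-_; _/_; 1/_; ≢-nonZero)
open import Data.Rational.Properties using (_≟_; _≤?_)
open import Data.Fin using (Fin; zero; suc)
open import Data.Bool using (Bool; true; false; if_then_else_)
open import Data.List using (List; []; _∷_; _++_; map; length; filter)
open import Relation.Nullary using (yes; no)

ℕtoℚ : ℕ → ℚ
ℕtoℚ n = + n / 1

-- total reciprocal (inv 0 = 0); only ever applied to nonzero values below
inv : ℚ → ℚ
inv q with q ≟ 0ℚ
... | yes _ = 0ℚ
... | no q≢0 = 1/_ q {{≢-nonZero q≢0}}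

Pt : ℕ → Set
Pt d = Fin d → ℚ

dot : ∀ {d} → Pt d → Pt d → ℚ
dot {zero}  u v = 0ℚ
dot {suc d} u v = u zero * v zero + dot (λ i → u (suc i)) (λ i → v (suc i))

sub : ∀ {d} → Pt d → Pt d → Pt d
sub u v i = u i - v i

-- the grid point a ∈ W(d,N) (coordinates in ℕ), as a point of ℚ^d
embed : ∀ {d} → (Fin d → ℕ) → Pt d
embed a i = ℕtoℚ (a i)

center : (d N : ℕ) → Pt d
center d N i = + N / 2

vertex : ∀ {d} → ℕ → (Fin d → Bool) → Pt d
vertex N b i = if b i then ℕtoℚ N else 0ℚ

-- squared normalized distance: dist_d(u,v)^2 = (1/(d N^2)) Σ (u_j - v_j)^2
distSq : (d N : ℕ) → Pt d → Pt d → ℚ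
distSq d N u v = inv (ℕtoℚ (d ℕ.* N ℕ.* N)) * dot (sub u v) (sub u v)

-- squared cosine of the angle at c of the triangle (a, c, v):
-- cos θ = ((a-c)·(v-c)) / (|a-c| |v-c|)
cosSqAt : ∀ {d} → Pt d → Pt d → Pt d → ℚ
cosSqAt c a v =
  dot (sub a c) (sub v c) * dot (sub a c) (sub v c)
    * inv (dot (sub a c) (sub a c) * dot (sub v c) (sub v c))

-- all 2^d Boolean vectors of length d (enumerating V(d,N))
allBool : (d : ℕ) → List (Fin d → Bool)
allBool zero = (λ ()) ∷ []
allBool (suc d) =
  map (λ b → cons true b) (allBool d) ++ map (λ b → cons false b) (allBool d)
  where
  cons : Bool → (Fin d → Bool) → Fin (suc d) → Bool
  cons x b zero = x
  cons x b (suc i) = b i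

-- number of vertices v with |cos θ_c(v)| ≤ ε, i.e. cos² θ_c(v) ≤ ε² (ε > 0)
goodCount : (d N : ℕ) → (Fin d → ℕ) → ℚ → ℕ
goodCount d N a ε =
  length (filter (λ b → cosSqAt (center d N) (embed a) (vertex N b) ≤? ε * ε) (allBool d))

goodProportion : (d N : ℕ) → (Fin d → ℕ) → ℚ → ℚ
goodProportion d N a ε = ℕtoℚ (goodCount d N a ε) * inv (ℕtoℚ (2 ℕ.^ d))

{-# OPTIONS --safe #-}
module Submission where

-- Put x = a − c and let y run over the 2^d vectors v − c, whose coordinates are ±N/2.
-- Then |y|² = d N²/4 for every vertex, and summing (x·y)² over all vertices cancels the
-- cross terms, leaving 2^d (N²/4) |x|². A vertex with cos² θ > ε² has
-- (x·y)² > ε² |x|² d N²/4, so by Markov's inequality at most 2^d / (ε² d) vertices are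
-- bad, which is at most ε 2^d once ε³ d ≥ 1.

open import Defs
open import Data.Nat as ℕ using (ℕ; zero; suc)
import Data.Nat.Properties as ℕ
open import Data.Integer as ℤ using (+_)
import Data.Integer.Properties as ℤ
import Data.Integer.Solver
open import Data.Rational as ℚ
  using (ℚ; mkℚ; 0ℚ; 1ℚ; ½; _+_; _*_; _-_; -_; _/_; _≤_; _<_; *<*; toℚᵘ; fromℚᵘ; positive; nonNegative; nonPositive)
open import Data.Rational.Properties
open import Data.Rational.Solver using (module +-*-Solver)
open import Data.Rational.Unnormalised as ℚᵘ using (mkℚᵘ; *≡*) renaming (_+_ to _+ᵘ_)
import Data.Rational.Unnormalised.Properties as ℚᵘ
open import Data.Fin using (Fin; zero; suc)
open import Data.Bool using (Bool; true; false; if_then_else_)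
open import Data.List using (List; []; _∷_; _++_; map; length; filter)
import Data.List.Properties as List
open import Data.Product using (Σ; ∃-syntax; _×_; _,_; proj₁; proj₂)
open import Data.Sum using (inj₁; inj₂)
open import Level using (Level)
open import Relation.Binary.PropositionalEquality
open import Data.Empty using (⊥-elim)
open import Relation.Nullary using (¬_; yes; no)
open import Relation.Unary using (Pred; Decidable)

fromℚᵘ-homo-+ : ∀ p q → fromℚᵘ (p +ᵘ q) ≡ fromℚᵘ p + fromℚᵘ q
fromℚᵘ-homo-+ p q = toℚᵘ-injective (begin-equality
  toℚᵘ (fromℚᵘ (p +ᵘ q))              ≃⟨ toℚᵘ-fromℚᵘ (p +ᵘ q) ⟩
  p +ᵘ q                              ≃⟨ ℚᵘ.+-cong (toℚᵘ-fromℚᵘ p) (toℚᵘ-fromℚᵘ q) ⟨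
  toℚᵘ (fromℚᵘ p) +ᵘ toℚᵘ (fromℚᵘ q)  ≃⟨ toℚᵘ-homo-+ (fromℚᵘ p) (fromℚᵘ q) ⟨
  toℚᵘ (fromℚᵘ p + fromℚᵘ q)          ∎)
  where open ℚᵘ.≤-Reasoning

ℕtoℚ-+ : ∀ m n → ℕtoℚ (m ℕ.+ n) ≡ ℕtoℚ m + ℕtoℚ n
ℕtoℚ-+ m n =
  trans (fromℚᵘ-cong {mkℚᵘ (+ (m ℕ.+ n)) 0} {mkℚᵘ (+ m) 0 +ᵘ mkℚᵘ (+ n) 0} (*≡* cross))
        (fromℚᵘ-homo-+ (mkℚᵘ (+ m) 0) (mkℚᵘ (+ n) 0))
  where
  open Data.Integer.Solver.+-*-Solver
  cross : + (m ℕ.+ n) ℤ.* + 1 ≡ (+ m ℤ.* + 1 ℤ.+ + n ℤ.* + 1) ℤ.* + 1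
  cross rewrite ℤ.pos-+ m n =
    solve 2 (λ x y → (x :+ y) :* con (+ 1) := (x :* con (+ 1) :+ y :* con (+ 1)) :* con (+ 1)) refl (+ m) (+ n)

ℕtoℚ-suc : ∀ n → ℕtoℚ (suc n) ≡ 1ℚ + ℕtoℚ n
ℕtoℚ-suc = ℕtoℚ-+ 1

N/2+N/2≡N : ∀ N → + N / 2 + + N / 2 ≡ ℕtoℚ N
N/2+N/2≡N N =
  sym (trans (fromℚᵘ-cong {mkℚᵘ (+ N) 0} {mkℚᵘ (+ N) 1 +ᵘ mkℚᵘ (+ N) 1} (*≡* cross))
             (fromℚᵘ-homo-+ (mkℚᵘ (+ N) 1) (mkℚᵘ (+ N) 1)))
  where
  open Data.Integer.Solver.+-*-Solver
  cross : + N ℤ.* + 4 ≡ (+ N ℤ.* + 2 ℤ.+ + N ℤ.* + 2) ℤ.* + 1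
  cross = solve 1 (λ x → x :* con (+ 4) := (x :* con (+ 2) :+ x :* con (+ 2)) :* con (+ 1)) refl (+ N)

open +-*-Solver

N-N/2≡N/2 : ∀ N → ℕtoℚ N - + N / 2 ≡ + N / 2
N-N/2≡N/2 N rewrite sym (N/2+N/2≡N N) = solve 1 (λ h → h :+ h :- h := h) refl (+ N / 2)

ℕtoℚ-nonNeg : ∀ n → 0ℚ ≤ ℕtoℚ n
ℕtoℚ-nonNeg n = nonNegative⁻¹ (ℕtoℚ n) {{normalize-nonNeg n 1}}

p≤p+q : ∀ p {q} → 0ℚ ≤ q → p ≤ p + q
p≤p+q p {q} 0≤q = subst (_≤ p + q) (+-identityʳ p) (+-monoʳ-≤ p 0≤q)

ℕtoℚ-mono-≤ : ∀ {m n} → m ℕ.≤ n → ℕtoℚ m ≤ ℕtoℚ n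
ℕtoℚ-mono-≤ {m} {n} m≤n = subst (ℕtoℚ m ≤_)
  (trans (sym (ℕtoℚ-+ m (n ℕ.∸ m))) (cong ℕtoℚ (ℕ.m+[n∸m]≡n m≤n)))
  (p≤p+q (ℕtoℚ m) (ℕtoℚ-nonNeg (n ℕ.∸ m)))

ℕtoℚ-pos : ∀ {n} → 1 ℕ.≤ n → 0ℚ < ℕtoℚ n
ℕtoℚ-pos {suc n} _ = positive⁻¹ (ℕtoℚ (suc n)) {{normalize-pos (suc n) 1}}

N/2-pos : ∀ {N} → 1 ℕ.≤ N → 0ℚ < + N / 2
N/2-pos {suc N} _ = positive⁻¹ (+ suc N / 2) {{normalize-pos (suc N) 2}}

*-pos : ∀ {p q} → 0ℚ < p → 0ℚ < q → 0ℚ < p * q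
*-pos {p} {q} 0<p 0<q = positive⁻¹ (p * q) {{pos*pos⇒pos p {{positive 0<p}} q {{positive 0<q}}}}

pos-if-≤-* : ∀ {p c q} → 0ℚ < p → p ≤ c * q → 0ℚ ≤ q → 0ℚ < q
pos-if-≤-* {p} {c} {q} 0<p p≤cq 0≤q with q ≤? 0ℚ
... | no q≰0 = ≰⇒> q≰0
... | yes q≤0 = ⊥-elim (<-irrefl refl (<-≤-trans 0<p (begin
  p       ≤⟨ p≤cq ⟩
  c * q   ≡⟨ cong (c *_) (≤-antisym q≤0 0≤q) ⟩
  c * 0ℚ  ≡⟨ *-zeroʳ c ⟩
  0ℚ      ∎)))
  where open ≤-Reasoning

archimedean : ∀ ε → 0ℚ < ε → ∃[ n ] 1ℚ ≤ ε * ℕtoℚ n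
archimedean (mkℚ (+ zero) _ _) (*<* (ℤ.+<+ ()))
archimedean (mkℚ ℤ.-[1+ _ ] _ _) (*<* ())
archimedean ε@(mkℚ (+ suc p) q _) _ = suc q , toℚᵘ-cancel-≤ (begin
  toℚᵘ 1ℚ                                 ≤⟨ ℚᵘ.*≤* (ℤ.+≤+ (ℕ.s≤s q≤[q+p*[1+q]]*1)) ⟩
  mkℚᵘ (+ suc p) q ℚᵘ.* mkℚᵘ (+ suc q) 0  ≃⟨ ℚᵘ.*-congˡ {toℚᵘ ε} (toℚᵘ-fromℚᵘ (mkℚᵘ (+ suc q) 0)) ⟨
  toℚᵘ ε ℚᵘ.* toℚᵘ (ℕtoℚ (suc q))        ≃⟨ toℚᵘ-homo-* ε (ℕtoℚ (suc q)) ⟨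
  toℚᵘ (ε * ℕtoℚ (suc q))                 ∎)
  where
  open ℚᵘ.≤-Reasoning
  q≤[q+p*[1+q]]*1 : q ℕ.* 1 ℕ.+ 0 ℕ.≤ (q ℕ.+ p ℕ.* suc q) ℕ.* 1
  q≤[q+p*[1+q]]*1 = ℕ.≤-trans (ℕ.≤-reflexive (ℕ.+-identityʳ (q ℕ.* 1))) (ℕ.*-monoˡ-≤ 1 (ℕ.m≤m+n q (p ℕ.* suc q)))

square-nonNeg : ∀ p → 0ℚ ≤ p * p
square-nonNeg p with ≤-total 0ℚ p
... | inj₁ 0≤p = nonNegative⁻¹ (p * p) {{nonNeg*nonNeg⇒nonNeg p {{nonNegative 0≤p}} p {{nonNegative 0≤p}}}}
... | inj₂ p≤0 = nonNegative⁻¹ (p * p) {{nonPos*nonPos⇒nonPos p {{nonPositive p≤0}} p {{nonPositive p≤0}}}}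

dot-self-nonNeg : ∀ {d} (x : Pt d) → 0ℚ ≤ dot x x
dot-self-nonNeg {zero}  x = ≤-refl
dot-self-nonNeg {suc d} x =
  subst (_≤ dot x x) (+-identityˡ 0ℚ) (+-mono-≤ (square-nonNeg (x zero)) (dot-self-nonNeg (λ i → x (suc i))))

inv-inverseˡ : ∀ z → 0ℚ < z → inv z * z ≡ 1ℚ
inv-inverseˡ z 0<z with z ≟ 0ℚ
... | yes refl = ⊥-elim (<-irrefl refl 0<z)
... | no z≢0 = *-inverseˡ z {{ℚ.≢-nonZero z≢0}}

inv-pos : ∀ z → 0ℚ < z → 0ℚ < inv z
inv-pos z 0<z with z ≟ 0ℚ
... | yes refl = ⊥-elim (<-irrefl refl 0<z)
... | no z≢0 = positive⁻¹ _ {{1/pos⇒pos z {{positive 0<z}}}}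

*inv≰⇒*< : ∀ {p q} z → 0ℚ < z → ¬ (p * inv z ≤ q) → q * z < p
*inv≰⇒*< {p} {q} z 0<z p/z≰q = begin-strict
  q * z            <⟨ *-monoˡ-<-pos z {{positive 0<z}} (≰⇒> p/z≰q) ⟩
  p * inv z * z    ≡⟨ *-assoc p (inv z) z ⟩
  p * (inv z * z)  ≡⟨ cong (p *_) (inv-inverseˡ z 0<z) ⟩
  p * 1ℚ           ≡⟨ *-identityʳ p ⟩
  p                ∎
  where open ≤-Reasoning

*≤⇒≤*inv : ∀ {p q} z → 0ℚ < z → p * z ≤ q → p ≤ q * inv z
*≤⇒≤*inv {p} {q} z 0<z pz≤q = begin
  p                  ≡⟨ *-identityʳ p ⟨
  p * 1ℚ             ≡⟨ cong (p *_) (inv-inverseˡ z 0<z) ⟨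
  p * (inv z * z)    ≡⟨ solve 3 (λ p i z → p :* (i :* z) := p :* z :* i) refl p (inv z) z ⟩
  p * z * inv z      ≤⟨ *-monoʳ-≤-nonNeg (inv z) {{nonNegative (<⇒≤ (inv-pos z 0<z))}} pz≤q ⟩
  q * inv z          ∎
  where open ≤-Reasoning

∑ : {B : Set} → List B → (B → ℚ) → ℚ
∑ []       w = 0ℚ
∑ (b ∷ bs) w = w b + ∑ bs w

∑-++ : {B : Set} (bs cs : List B) (w : B → ℚ) → ∑ (bs ++ cs) w ≡ ∑ bs w + ∑ cs w
∑-++ []       cs w = sym (+-identityˡ (∑ cs w))
∑-++ (b ∷ bs) cs w = trans (cong (_+_ (w b)) (∑-++ bs cs w)) (sym (+-assoc (w b) (∑ bs w) (∑ cs w)))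

∑-map : {B C : Set} (f : B → C) (bs : List B) (w : C → ℚ) → ∑ (map f bs) w ≡ ∑ bs (λ b → w (f b))
∑-map f []       w = refl
∑-map f (b ∷ bs) w = cong (_+_ (w (f b))) (∑-map f bs w)

∑-cong : {B : Set} (bs : List B) {v w : B → ℚ} → (∀ b → v b ≡ w b) → ∑ bs v ≡ ∑ bs w
∑-cong []       v≗w = refl
∑-cong (b ∷ bs) v≗w = cong₂ _+_ (v≗w b) (∑-cong bs v≗w)

∑-+ : {B : Set} (bs : List B) (v w : B → ℚ) → ∑ bs (λ b → v b + w b) ≡ ∑ bs v + ∑ bs w
∑-+ []       v w = sym (+-identityˡ 0ℚ)
∑-+ (b ∷ bs) v w = trans (cong (_+_ (v b + w b)) (∑-+ bs v w))
  (solve 4 (λ a b c d → (a :+ b) :+ (c :+ d) := (a :+ c) :+ (b :+ d)) refl (v b) (w b) (∑ bs v) (∑ bs w))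

ℕtoℚ-suc-* : ∀ n p → ℕtoℚ (suc n) * p ≡ p + ℕtoℚ n * p
ℕtoℚ-suc-* n p = begin
  ℕtoℚ (suc n) * p   ≡⟨ cong (_* p) (ℕtoℚ-suc n) ⟩
  (1ℚ + ℕtoℚ n) * p  ≡⟨ solve 2 (λ n p → (con 1ℚ :+ n) :* p := p :+ n :* p) refl (ℕtoℚ n) p ⟩
  p + ℕtoℚ n * p     ∎
  where open ≡-Reasoning

∑-const : {B : Set} (bs : List B) (p : ℚ) → ∑ bs (λ _ → p) ≡ ℕtoℚ (length bs) * p
∑-const []       p = sym (*-zeroˡ p)
∑-const (b ∷ bs) p = trans (cong (_+_ p) (∑-const bs p)) (sym (ℕtoℚ-suc-* (length bs) p))

markov-count : {B : Set} {ℓ : Level} {P : Pred B ℓ} (P? : Decidable P) (w : B → ℚ) (E : ℚ) →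
  (∀ b → 0ℚ ≤ w b) → (∀ b → ¬ P b → E ≤ w b) →
  ∀ bs → ℕtoℚ (length bs) * E ≤ ℕtoℚ (length (filter P? bs)) * E + ∑ bs w
markov-count P? w E w≥0 bad [] = ≤-reflexive (sym (+-identityʳ (0ℚ * E)))
markov-count P? w E w≥0 bad (b ∷ bs) with P? b
... | yes _ = begin
  ℕtoℚ (suc n) * E           ≡⟨ ℕtoℚ-suc-* n E ⟩
  E + ℕtoℚ n * E             ≤⟨ +-monoʳ-≤ E (markov-count P? w E w≥0 bad bs) ⟩
  E + (ℕtoℚ k * E + S)       ≤⟨ p≤p+q _ (w≥0 b) ⟩
  E + (ℕtoℚ k * E + S) + w b ≡⟨ solve 4 (λ e g s v → e :+ (g :+ s) :+ v := (e :+ g) :+ (v :+ s)) refl E (ℕtoℚ k * E) S (w b) ⟩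
  (E + ℕtoℚ k * E) + (w b + S) ≡⟨ cong (_+ (w b + S)) (ℕtoℚ-suc-* k E) ⟨
  ℕtoℚ (suc k) * E + (w b + S) ∎
  where
  open ≤-Reasoning
  n = length bs
  k = length (filter P? bs)
  S = ∑ bs w
... | no ¬Pb = begin
  ℕtoℚ (suc n) * E           ≡⟨ ℕtoℚ-suc-* n E ⟩
  E + ℕtoℚ n * E             ≤⟨ +-mono-≤ (bad b ¬Pb) (markov-count P? w E w≥0 bad bs) ⟩
  w b + (ℕtoℚ k * E + S)     ≡⟨ solve 3 (λ v g s → v :+ (g :+ s) := g :+ (v :+ s)) refl (w b) (ℕtoℚ k * E) S ⟩
  ℕtoℚ k * E + (w b + S)     ∎
  where
  open ≤-Reasoning
  n = length bs
  k = length (filter P? bs)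
  S = ∑ bs w

length-allBool : ∀ d → length (allBool d) ≡ 2 ℕ.^ d
length-allBool zero    = refl
length-allBool (suc d) = begin
  length (map _ (allBool d) ++ map _ (allBool d))      ≡⟨ List.length-++ (map _ (allBool d)) ⟩
  length (map _ (allBool d)) ℕ.+ length (map _ (allBool d))
    ≡⟨ cong₂ ℕ._+_ (List.length-map _ (allBool d)) (List.length-map _ (allBool d)) ⟩
  length (allBool d) ℕ.+ length (allBool d)            ≡⟨ cong₂ ℕ._+_ (length-allBool d) (length-allBool d) ⟩
  2 ℕ.^ d ℕ.+ 2 ℕ.^ d                                  ≡⟨ cong (2 ℕ.^ d ℕ.+_) (ℕ.+-identityʳ (2 ℕ.^ d)) ⟨
  2 ℕ.^ suc d                                          ∎
  where open ≡-Reasoning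

ℕtoℚ-2^suc : ∀ d → ℕtoℚ (2 ℕ.^ suc d) ≡ ℕtoℚ (2 ℕ.^ d) + ℕtoℚ (2 ℕ.^ d)
ℕtoℚ-2^suc d = trans (ℕtoℚ-+ (2 ℕ.^ d) (2 ℕ.^ d ℕ.+ 0)) (cong (λ k → ℕtoℚ (2 ℕ.^ d) + ℕtoℚ k) (ℕ.+-identityʳ (2 ℕ.^ d)))

centredVertex : ∀ {d} → ℕ → (Fin d → Bool) → Pt d
centredVertex {d} N b = sub (vertex N b) (center d N)

centredCoordinate² : ∀ N x → let c = if x then ℕtoℚ N else 0ℚ in
  (c - + N / 2) * (c - + N / 2) ≡ + N / 2 * (+ N / 2)
centredCoordinate² N true  = cong (λ c → c * c) (N-N/2≡N/2 N)
centredCoordinate² N false = solve 1 (λ h → (con 0ℚ :- h) :* (con 0ℚ :- h) := h :* h) refl (+ N / 2)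

dot-centredVertex-self : ∀ d N (b : Fin d → Bool) →
  dot (centredVertex N b) (centredVertex N b) ≡ ℕtoℚ d * (+ N / 2 * (+ N / 2))
dot-centredVertex-self zero    N b = sym (*-zeroˡ (+ N / 2 * (+ N / 2)))
dot-centredVertex-self (suc d) N b = begin
  centredVertex N b zero * centredVertex N b zero + dot (centredVertex N b′) (centredVertex N b′)
    ≡⟨ cong₂ _+_ (centredCoordinate² N (b zero)) (dot-centredVertex-self d N b′) ⟩
  h * h + ℕtoℚ d * (h * h)   ≡⟨ ℕtoℚ-suc-* d (h * h) ⟨
  ℕtoℚ (suc d) * (h * h)     ∎
  where
  open ≡-Reasoning
  h = + N / 2
  b′ = λ i → b (suc i)

∑-dot-centredVertex² : ∀ d N (x : Pt d) →
  ∑ (allBool d) (λ b → dot x (centredVertex N b) * dot x (centredVertex N b))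
    ≡ ℕtoℚ (2 ℕ.^ d) * (+ N / 2 * (+ N / 2) * dot x x)
∑-dot-centredVertex² zero    N x = solve 1 (λ h → con 0ℚ :* con 0ℚ :+ con 0ℚ := con 1ℚ :* (h :* h :* con 0ℚ)) refl (+ N / 2)
∑-dot-centredVertex² (suc d) N x = begin
  ∑ (allBool (suc d)) (λ b → D′ b * D′ b)
    ≡⟨ trans (∑-++ (map _ A) (map _ A) (λ b → D′ b * D′ b)) (cong₂ _+_ (∑-map _ A _) (∑-map _ A _)) ⟩
  ∑ A (λ b → sq (x₀ * (ℕtoℚ N - h) + D b)) + ∑ A (λ b → sq (x₀ * (0ℚ - h) + D b))
    ≡⟨ ∑-+ A _ _ ⟨
  ∑ A (λ b → sq (x₀ * (ℕtoℚ N - h) + D b) + sq (x₀ * (0ℚ - h) + D b))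
    ≡⟨ ∑-cong A (λ b → trans (cong (λ t → sq (x₀ * t + D b) + sq (x₀ * (0ℚ - h) + D b)) (N-N/2≡N/2 N)) (opposite-squares (D b))) ⟩
  ∑ A (λ b → (sq x₀ * sq h + sq x₀ * sq h) + (sq (D b) + sq (D b)))
    ≡⟨ trans (∑-+ A _ _) (cong₂ _+_ (∑-const A _) (∑-+ A _ _)) ⟩
  ℕtoℚ (length A) * (sq x₀ * sq h + sq x₀ * sq h) + (∑ A (λ b → sq (D b)) + ∑ A (λ b → sq (D b)))
    ≡⟨ cong₂ (λ n s → ℕtoℚ n * (sq x₀ * sq h + sq x₀ * sq h) + (s + s)) (length-allBool d) (∑-dot-centredVertex² d N x′) ⟩
  P * (sq x₀ * sq h + sq x₀ * sq h) + (P * (sq h * dot x′ x′) + P * (sq h * dot x′ x′))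
    ≡⟨ solve 4 (λ P x h X → P :* (x :* x :* (h :* h) :+ x :* x :* (h :* h)) :+ (P :* (h :* h :* X) :+ P :* (h :* h :* X))
                        := (P :+ P) :* (h :* h :* (x :* x :+ X))) refl P x₀ h (dot x′ x′) ⟩
  (P + P) * (sq h * dot x x)
    ≡⟨ cong (_* (sq h * dot x x)) (ℕtoℚ-2^suc d) ⟨
  ℕtoℚ (2 ℕ.^ suc d) * (sq h * dot x x) ∎
  where
  open ≡-Reasoning
  sq : ℚ → ℚ
  sq q = q * q
  A = allBool d
  h = + N / 2
  P = ℕtoℚ (2 ℕ.^ d)
  x₀ = x zero
  x′ : Pt d
  x′ i = x (suc i)
  D : (Fin d → Bool) → ℚ
  D b = dot x′ (centredVertex N b)
  D′ : (Fin (suc d) → Bool) → ℚ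
  D′ b = dot x (centredVertex N b)
  opposite-squares : ∀ e → sq (x₀ * h + e) + sq (x₀ * (0ℚ - h) + e) ≡ (sq x₀ * sq h + sq x₀ * sq h) + (sq e + sq e)
  opposite-squares e = solve 3 (λ x h e → (x :* h :+ e) :* (x :* h :+ e) :+ (x :* (con 0ℚ :- h) :+ e) :* (x :* (con 0ℚ :- h) :+ e)
                                 := (x :* x :* (h :* h) :+ x :* x :* (h :* h)) :+ (e :* e :+ e :* e)) refl x₀ h e

goodCount≤2^d : ∀ d N a ε → ℕtoℚ (goodCount d N a ε) ≤ ℕtoℚ (2 ℕ.^ d)
goodCount≤2^d d N a ε = ℕtoℚ-mono-≤ (subst (goodCount d N a ε ℕ.≤_) (length-allBool d) (List.length-filter _ (allBool d)))

proportion-bound : ∀ {ε s g n} → 0ℚ < n → 0ℚ ≤ ε → g ≤ n → 1ℚ ≤ ε * s →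
  n * s ≤ g * s + n → 1ℚ - ε ≤ g * inv n
proportion-bound {ε} {s} {g} {n} 0<n 0≤ε g≤n 1≤εs ns≤gs+n = *≤⇒≤*inv n 0<n (begin
  (1ℚ - ε) * n         ≡⟨ solve 3 (λ e n g → (con 1ℚ :- e) :* n := (n :- g) :+ (g :- e :* n)) refl ε n g ⟩
  (n - g) + (g - ε * n) ≤⟨ +-monoˡ-≤ (g - ε * n) n-g≤εn ⟩
  ε * n + (g - ε * n)   ≡⟨ solve 3 (λ e n g → e :* n :+ (g :- e :* n) := g) refl ε n g ⟩
  g                     ∎)
  where
  open ≤-Reasoning
  0≤n-g : 0ℚ ≤ n - g
  0≤n-g = subst (_≤ n - g) (+-inverseʳ g) (+-monoˡ-≤ (- g) g≤n)
  ns-gs≤n : n * s - g * s ≤ n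
  ns-gs≤n = subst (n * s - g * s ≤_) (solve 3 (λ g s n → g :* s :+ n :- g :* s := n) refl g s n)
                  (+-monoˡ-≤ (- (g * s)) ns≤gs+n)
  n-g≤εn : n - g ≤ ε * n
  n-g≤εn = begin
    n - g                 ≡⟨ *-identityʳ (n - g) ⟨
    (n - g) * 1ℚ          ≤⟨ *-monoˡ-≤-nonNeg (n - g) {{nonNegative 0≤n-g}} 1≤εs ⟩
    (n - g) * (ε * s)     ≡⟨ solve 4 (λ n g e s → (n :- g) :* (e :* s) := e :* (n :* s :- g :* s)) refl n g ε s ⟩
    ε * (n * s - g * s)   ≤⟨ *-monoˡ-≤-nonNeg ε {{nonNegative 0≤ε}} ns-gs≤n ⟩
    ε * n                 ∎

goodCount-bound : ∀ ε d N (a : Fin d → ℕ) → 1 ℕ.≤ d → 1 ℕ.≤ N →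
  0ℚ < dot (sub (embed a) (center d N)) (sub (embed a) (center d N)) →
  ℕtoℚ (2 ℕ.^ d) * (ε * ε * ℕtoℚ d) ≤ ℕtoℚ (goodCount d N a ε) * (ε * ε * ℕtoℚ d) + ℕtoℚ (2 ℕ.^ d)
goodCount-bound ε d N a d≥1 N≥1 0<X = *-cancelʳ-≤-pos K {{positive 0<K}} (begin
  P * s * K                            ≡⟨ solve 5 (λ P e X n h → P :* (e :* e :* n) :* (h :* h :* X)
                                                   := P :* (e :* e :* (X :* (n :* (h :* h))))) refl P ε X (ℕtoℚ d) h ⟩
  P * E                                ≡⟨ cong (λ k → ℕtoℚ k * E) (length-allBool d) ⟨
  ℕtoℚ (length (allBool d)) * E        ≤⟨ markov-count good? w E (λ b → square-nonNeg (dot x (centredVertex N b))) bad (allBool d) ⟩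
  G * E + ∑ (allBool d) w              ≡⟨ cong (_+_ (G * E)) (∑-dot-centredVertex² d N x) ⟩
  G * E + P * K                        ≡⟨ solve 6 (λ G P e X n h → G :* (e :* e :* (X :* (n :* (h :* h)))) :+ P :* (h :* h :* X)
                                                   := (G :* (e :* e :* n) :+ P) :* (h :* h :* X)) refl G P ε X (ℕtoℚ d) h ⟩
  (G * s + P) * K                      ∎)
  where
  open ≤-Reasoning
  x = sub (embed a) (center d N)
  X = dot x x
  h = + N / 2
  Y = ℕtoℚ d * (h * h)
  E = ε * ε * (X * Y)
  K = h * h * X
  s = ε * ε * ℕtoℚ d
  P = ℕtoℚ (2 ℕ.^ d)
  G = ℕtoℚ (goodCount d N a ε)
  good? = λ (b : Fin d → Bool) → cosSqAt (center d N) (embed a) (vertex N b) ≤? ε * ε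
  w : (Fin d → Bool) → ℚ
  w b = dot x (centredVertex N b) * dot x (centredVertex N b)
  0<hh : 0ℚ < h * h
  0<hh = *-pos (N/2-pos N≥1) (N/2-pos N≥1)
  0<K : 0ℚ < K
  0<K = *-pos 0<hh 0<X
  0<XY : 0ℚ < X * Y
  0<XY = *-pos 0<X (*-pos (ℕtoℚ-pos d≥1) 0<hh)
  bad : ∀ b → ¬ (cosSqAt (center d N) (embed a) (vertex N b) ≤ ε * ε) → E ≤ w b
  bad b cos²>ε² = <⇒≤ (*inv≰⇒*< (X * Y) 0<XY
    (subst (λ y → ¬ (w b * inv (X * y) ≤ ε * ε)) (dot-centredVertex-self d N b) cos²>ε²))

theorem1p2 : (ε : ℚ) → 0ℚ < ε →
    Σ ℕ λ dε → Σ (ℕ → ℚ) λ f →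
      ((d : ℕ) → 1 ℕ.≤ d → (0ℚ < f d) × (f d ≤ ½)) ×
      ((d N : ℕ) → 1 ℕ.≤ d → dε ℕ.≤ d → 1 ℕ.≤ N →
        (a : Fin d → ℕ) → ((i : Fin d) → a i ℕ.≤ N) →
        f d * f d ≤ distSq d N (embed a) (center d N) →
        1ℚ - ε ≤ goodProportion d N a ε)
theorem1p2 ε 0<ε = m , (λ _ → ½) , (λ _ _ → positive⁻¹ ½ , ≤-refl) ,
  λ d N d≥1 m≤d N≥1 a _ far →
    proportion-bound (ℕtoℚ-pos (ℕ.m^n>0 2 d)) (<⇒≤ 0<ε) (goodCount≤2^d d N a ε) (1≤ε³d m≤d)
      (goodCount-bound ε d N a d≥1 N≥1
        (pos-if-≤-* {c = inv (ℕtoℚ (d ℕ.* N ℕ.* N))} (positive⁻¹ (½ * ½)) far (dot-self-nonNeg (sub (embed a) (center d N)))))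
  where
  0<ε³ : 0ℚ < ε * ε * ε
  0<ε³ = *-pos (*-pos 0<ε 0<ε) 0<ε
  m : ℕ
  m = proj₁ (archimedean (ε * ε * ε) 0<ε³)
  1≤ε³d : ∀ {d} → m ℕ.≤ d → 1ℚ ≤ ε * (ε * ε * ℕtoℚ d)
  1≤ε³d {d} m≤d = begin
    1ℚ                      ≤⟨ proj₂ (archimedean (ε * ε * ε) 0<ε³) ⟩
    ε * ε * ε * ℕtoℚ m      ≤⟨ *-monoˡ-≤-nonNeg (ε * ε * ε) {{nonNegative (<⇒≤ 0<ε³)}} (ℕtoℚ-mono-≤ m≤d) ⟩
    ε * ε * ε * ℕtoℚ d      ≡⟨ solve 2 (λ e n → e :* e :* e :* n := e :* (e :* e :* n)) refl ε (ℕtoℚ d) ⟩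
    ε * (ε * ε * ℕtoℚ d)    ∎
    where open ≤-Reasoning
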